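{- If $t\ge 3$ and $G$ is any 2-tree on $3t+1$ vertices, then $G(3t+1)$ contains $G$ as a subgraph.
   Context: A simple graph $G$ is a 2-tree if $G=K_3$, or $G$ has a vertex $v$ of degree 2 whose two neighbors are adjacent and $G-v$ is a 2-tree. $G(3t+1)$ is the graph obtained from $K_{2t+1}-v_{2t-2}v_{2t}$ (where $K_{2t+1}$ has vertices $v_1,\ldots,v_{2t+1}$) by adding new vertices $x_1,\ldots,x_t$ and joining $x_i$ to $v_1,\ldots,v_{2i}$ for $1\le i\le t$. -}

module Defs where

open import Data.Nat using (ℕ; zero; suc; _+_; _*_; _∸_; _<_; _≤_; s≤s; z≤n)
open import Data.Nat.Properties using (≤-trans; m≤m+n; +-monoʳ-≤; <-irrefl; ≤-reflexive)
open import Data.Fin using (Fin; toℕ; punchIn)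
open import Data.Fin.Properties using (toℕ-injective)
open import Data.Product using (Σ; ∃; _×_; _,_)
open import Data.Sum using (_⊎_)
open import Data.Empty using (⊥)
open import Relation.Nullary using (¬_)
open import Relation.Binary.PropositionalEquality using (_≡_; _≢_; refl; sym; cong; subst)
open import Function.Definitions using (Injective)

record Graph (n : ℕ) : Set₁ where
  field
    Adj     : Fin n → Fin n → Set
    Adj-sym : ∀ {i j} → Adj i j → Adj j i
    Adj-irr : ∀ {i} → ¬ Adj i i
open Graph public

deleteV : ∀ {n} → Graph (suc n) → Fin (suc n) → Graph n
deleteV G v = record
  { Adj     = λ i j → Adj G (punchIn v i) (punchIn v j)
  ; Adj-sym = Adj-sym G
  ; Adj-irr = Adj-irr G
  }

Deg2Tri : ∀ {n} → Graph n → Fin n → Set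
Deg2Tri G v = ∃ λ a → ∃ λ b →
  a ≢ b × Adj G v a × Adj G v b × Adj G a b ×
  (∀ w → Adj G v w → w ≡ a ⊎ w ≡ b)

Complete : ∀ {n} → Graph n → Set
Complete G = ∀ i j → i ≢ j → Adj G i j

data TwoTree : ∀ {n} → Graph n → Set₁ where
  k3  : (G : Graph 3) → Complete G → TwoTree G
  ext : ∀ {n} (G : Graph (suc n)) (v : Fin (suc n)) →
        Deg2Tri G v → TwoTree (deleteV G v) → TwoTree G

_⊆G_ : ∀ {n m} → Graph n → Graph m → Set
_⊆G_ {n} {m} G H = Σ (Fin n → Fin m) λ f →
  Injective _≡_ _≡_ f × (∀ i j → Adj G i j → Adj H (f i) (f j))

-- The graph G(3t+1) on vertices 0 .. 3t (as naturals):
--   index k (0 ≤ k ≤ 2t)  is v_{k+1};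
--   index 2t+i (1 ≤ i ≤ t) is x_i.
-- Edges: all pairs of distinct v's except v_{2t-2} v_{2t} (indices 2t-3, 2t-1);
--        x_i ~ v_k for k ≤ 2i, i.e. index a < 2i.
data GE (t : ℕ) : ℕ → ℕ → Set where
  vv : ∀ {a b} → a < 2 * t + 1 → b < 2 * t + 1 → a ≢ b →
       ¬ (a ≡ 2 * t ∸ 3 × b ≡ 2 * t ∸ 1) →
       ¬ (a ≡ 2 * t ∸ 1 × b ≡ 2 * t ∸ 3) → GE t a b
  vx : ∀ {a b} i → a < 2 * t + 1 → 1 ≤ i → i ≤ t → a < 2 * i →
       b ≡ 2 * t + i → GE t a b
  xv : ∀ {a b} i → a < 2 * t + 1 → 1 ≤ i → i ≤ t → a < 2 * i →
       b ≡ 2 * t + i → GE t b a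

GE-sym : ∀ {t a b} → GE t a b → GE t b a
GE-sym (vv p q ne h1 h2) = vv q p (λ e → ne (sym e))
  (λ { (x , y) → h2 (y , x) }) (λ { (x , y) → h1 (y , x) })
GE-sym (vx i p q r s e) = xv i p q r s e
GE-sym (xv i p q r s e) = vx i p q r s e

private
  bad : ∀ {t a i} → a < 2 * t + 1 → 1 ≤ i → a ≡ 2 * t + i → ⊥
  bad {t} {a} {i} p q e = <-irrefl refl (≤-trans p (subst (2 * t + 1 ≤_) (sym e) (+-monoʳ-≤ (2 * t) q)))

GE-irr : ∀ {t a} → ¬ GE t a a
GE-irr (vv _ _ ne _ _) = ne refl
GE-irr {t} (vx i p q _ _ e) = bad {t} p q e
GE-irr {t} (xv i p q _ _ e) = bad {t} p q e

Gspecial : (t : ℕ) → Graph (3 * t + 1)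
Gspecial t = record
  { Adj     = λ i j → GE t (toℕ i) (toℕ j)
  ; Adj-sym = GE-sym {t}
  ; Adj-irr = GE-irr {t}
  }

module Submission where

-- We prove a stronger statement by induction on t: every injective family of 3t+1 vertices of a
-- 2-tree G (of any size) can be placed in G(3t+1), i.e. labelled injectively by the vertices of
-- G(3t+1) so that every edge of G between them is an edge of G(3t+1).  For the family of all
-- vertices, inverting the labelling gives the theorem.
--
-- Degeneracy yields a pivot: a member s whose neighbours in the family lie
-- in {p, q}.  The induction step puts p, q at v₁, v₂ and s at x₁ and renumbers a placement of the
-- remaining vertices from G(3t+1) into G(3t+4).  The base case t = 3 goes through G(7): seven
-- vertices with a pivot can be placed in G(7) unless they are saturated (every other member sees both
-- p and q), which a case analysis on the remaining four establishes; in the saturated case the K₃,₃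
-- bound gives a second pivot of the ten vertices which works.


open import Defs
open import Data.Nat using (ℕ; _≤_; _*_; _+_)
open import Data.Nat using (zero; suc; _∸_; _<_; s≤s; z≤n; _≤?_; _<?_) renaming (_≟_ to _≟ℕ_)
open import Data.Nat.Properties using (≤-refl; ≤-trans; ≤-pred; <-irrefl; +-comm; +-suc; m≤m+n; m≤n⇒∃[o]m+o≡n; +-cancelˡ-≤; suc-injective; +-∸-assoc; ≰⇒>; ≤∧≢⇒<)
open import Data.Nat.Tactic.RingSolver using (solve-∀)
open import Data.Bool using (Bool; true; false)
open import Data.Fin using (Fin; zero; suc; toℕ; fromℕ<; punchIn; punchOut; #_; cast)
open import Data.Fin.Properties using (toℕ-cast; toℕ-fromℕ<; toℕ<n; toℕ-injective; punchIn-injective; punchInᵢ≢i; punchOut-injective; punchIn-punchOut; any?; all?; pigeonhole; _≟_) renaming (<-irrefl to <-irreflᶠ)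
open import Data.Vec using (Vec; []; _∷_; lookup)
open import Data.Product using (∃; ∃₂; _×_; _,_; proj₁; proj₂)
open import Data.Sum using (_⊎_; inj₁; inj₂; [_,_])
import Data.Sum as Sum
open import Data.Empty using (⊥; ⊥-elim)
open import Function using (_∘_)
open import Function.Definitions using (Injective)
open import Relation.Nullary using (¬_; Dec; yes; no)
open import Relation.Nullary.Decidable using (True; False; toWitness; toWitnessFalse; _×-dec_; _→-dec_; ¬?; isYes)
open import Relation.Binary.PropositionalEquality using (_≡_; _≢_; refl; sym; trans; cong; subst; subst₂; module ≡-Reasoning)

Inj : ∀ {m n} → (Fin m → Fin n) → Set
Inj = Injective _≡_ _≡_

noThreeInPair : ∀ {I X : Set} {A : I → Set} (f : I → X) {a b : X} →
                (∀ i → A i → f i ≡ a ⊎ f i ≡ b) →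
                ∀ {x y z} → f x ≢ f y → f x ≢ f z → f y ≢ f z → A x → A y → A z → ⊥
noThreeInPair f cover {x} {y} {z} xy xz yz ax ay az
  with cover x ax | cover y ay | cover z az
... | inj₁ p | inj₁ q | _      = xy (trans p (sym q))
... | inj₂ p | inj₂ q | _      = xy (trans p (sym q))
... | inj₁ p | _      | inj₁ r = xz (trans p (sym r))
... | inj₂ p | _      | inj₂ r = xz (trans p (sym r))
... | _      | inj₁ q | inj₁ r = yz (trans q (sym r))
... | _      | inj₂ q | inj₂ r = yz (trans q (sym r))

othersInFin3 : (u : Fin 3) → ∃₂ λ a b → ∀ w → w ≢ u → w ≡ a ⊎ w ≡ b
othersInFin3 zero = suc zero , suc (suc zero) , λ
  { zero ne → ⊥-elim (ne refl) ; (suc zero) _ → inj₁ refl ; (suc (suc zero)) _ → inj₂ refl }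
othersInFin3 (suc zero) = zero , suc (suc zero) , λ
  { zero _ → inj₁ refl ; (suc zero) ne → ⊥-elim (ne refl) ; (suc (suc zero)) _ → inj₂ refl }
othersInFin3 (suc (suc zero)) = zero , suc zero , λ
  { zero _ → inj₁ refl ; (suc zero) _ → inj₂ refl ; (suc (suc zero)) ne → ⊥-elim (ne refl) }

neitherOr : ∀ {X Y : Set} → Dec X → Dec Y → (¬ X × ¬ Y) ⊎ (X ⊎ Y)
neitherOr (no ¬x) (no ¬y) = inj₁ (¬x , ¬y)
neitherOr (yes x) _ = inj₂ (inj₁ x)
neitherOr (no _) (yes y) = inj₂ (inj₂ y)

fresh : ∀ {m} (u v : Fin (3 + m)) → ∃ λ w → w ≢ u × w ≢ v
fresh u v with zero ≟ u | zero ≟ v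
... | no a | no b = zero , a , b
... | yes refl | _ with suc zero ≟ v
...   | no b = suc zero , (λ ()) , b
...   | yes refl = suc (suc zero) , (λ ()) , (λ ())
fresh u v | no a | yes refl with suc zero ≟ u
...   | no b = suc zero , b , (λ ())
...   | yes refl = suc (suc zero) , (λ ()) , (λ ())

Cover2 : ∀ {M} (A : Fin M → Set) → Fin M → Fin M → Set
Cover2 A x y = ∀ j → A j → j ≡ x ⊎ j ≡ y

moveAway : ∀ {m} {A : Fin (3 + m) → Set} (i y x : Fin (3 + m)) → Cover2 A x y → ¬ A i →
           ∃ λ x' → x' ≢ i × x' ≢ y × Cover2 A x' y
moveAway {A = A} i y x cover i∉A with x ≟ i | x ≟ y
... | no x≢i | no x≢y = x , x≢i , x≢y , cover
... | yes refl | _ = let (w , w≢i , w≢y) = fresh i y in w , w≢i , w≢y , λ j aj → onlyY (cover j aj) aj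
  where onlyY : ∀ {j w} → j ≡ x ⊎ j ≡ y → A j → j ≡ w ⊎ j ≡ y
        onlyY (inj₁ refl) aj = ⊥-elim (i∉A aj)
        onlyY (inj₂ e) _ = inj₂ e
... | no _ | yes refl = let (w , w≢i , w≢y) = fresh i y in w , w≢i , w≢y , λ j aj → inj₂ (merge (cover j aj))
  where merge : ∀ {j} → j ≡ x ⊎ j ≡ x → j ≡ x
        merge (inj₁ e) = e
        merge (inj₂ e) = e

twoDistinctSlots : ∀ {m} {A : Fin (3 + m) → Set} (i x y : Fin (3 + m)) → Cover2 A x y → ¬ A i →
                   ∃₂ λ p q → p ≢ q × i ≢ p × i ≢ q × Cover2 A p q
twoDistinctSlots i x y cover i∉A =
  let (p , p≢i , _ , coverₚ) = moveAway i y x cover i∉A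
      (q , q≢i , q≢p , coverₚq) = moveAway i p y (λ j aj → Sum.swap (coverₚ j aj)) i∉A
  in p , q , (λ e → q≢p (sym e)) , (λ e → p≢i (sym e)) , (λ e → q≢i (sym e)) , λ j aj → Sum.swap (coverₚq j aj)

record Complement3 {m} (a b c : Fin (3 + m)) : Set where
  field
    elem      : Fin m → Fin (3 + m)
    injective : Inj elem
    avoids-a  : ∀ y → elem y ≢ a
    avoids-b  : ∀ y → elem y ≢ b
    avoids-c  : ∀ y → elem y ≢ c
    onto      : ∀ x → x ≢ a → x ≢ b → x ≢ c → ∃ λ y → elem y ≡ x

complement3 : ∀ {m} (a b c : Fin (3 + m)) → a ≢ b → a ≢ c → b ≢ c → Complement3 a b c
complement3 {m} a b c a≢b a≢c b≢c = record
  { elem = elem ; injective = injective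
  ; avoids-a = λ y → punchInᵢ≢i a _ ; avoids-b = avoids-b ; avoids-c = avoids-c ; onto = onto }
  where
    b′ c′ : Fin (2 + m)
    b′ = punchOut a≢b
    c′ = punchOut a≢c
    b′≢c′ : b′ ≢ c′
    b′≢c′ e = b≢c (punchOut-injective a≢b a≢c e)
    c″ : Fin (1 + m)
    c″ = punchOut b′≢c′
    inner : Fin m → Fin (2 + m)
    inner y = punchIn b′ (punchIn c″ y)
    elem : Fin m → Fin (3 + m)
    elem y = punchIn a (inner y)
    injective : Inj elem
    injective e = punchIn-injective c″ _ _ (punchIn-injective b′ _ _ (punchIn-injective a _ _ e))
    -- elem y = b would give inner y = b′
    avoids-b : ∀ y → elem y ≢ b
    avoids-b y e = punchInᵢ≢i b′ _ (punchIn-injective a _ _ (trans e (sym (punchIn-punchOut a≢b))))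
    avoids-c : ∀ y → elem y ≢ c
    avoids-c y e = punchInᵢ≢i c″ y (punchIn-injective b′ _ _
      (trans (punchIn-injective a _ _ (trans e (sym (punchIn-punchOut a≢c)))) (sym (punchIn-punchOut b′≢c′))))
    onto : ∀ x → x ≢ a → x ≢ b → x ≢ c → ∃ λ y → elem y ≡ x
    onto x x≢a x≢b x≢c = punchOut x₂≢c″ , (begin
        punchIn a (punchIn b′ (punchIn c″ (punchOut x₂≢c″)))
          ≡⟨ cong (λ z → punchIn a (punchIn b′ z)) (punchIn-punchOut x₂≢c″) ⟩
        punchIn a (punchIn b′ x₂) ≡⟨ cong (punchIn a) (punchIn-punchOut x₁≢b′) ⟩
        punchIn a x₁              ≡⟨ punchIn-punchOut a≢x ⟩
        x ∎)
      where
        open ≡-Reasoning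
        a≢x : a ≢ x
        a≢x e = x≢a (sym e)
        x₁ : Fin (2 + m)
        x₁ = punchOut a≢x
        x₁≢b′ : b′ ≢ x₁
        x₁≢b′ e = x≢b (trans (sym (punchIn-punchOut a≢x)) (trans (cong (punchIn a) (sym e)) (punchIn-punchOut a≢b)))
        x₂ : Fin (1 + m)
        x₂ = punchOut x₁≢b′
        x₂≢c″ : c″ ≢ x₂
        x₂≢c″ e = x≢c (trans (sym (punchIn-punchOut a≢x))
          (trans (cong (punchIn a) (trans (sym (punchIn-punchOut x₁≢b′))
                   (trans (cong (punchIn b′) (sym e)) (punchIn-punchOut b′≢c′))))
                 (punchIn-punchOut a≢c)))

injective⇒surjective : ∀ {n} (r : Fin n → Fin n) → Inj r → ∀ u → ∃ λ j → r j ≡ u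
injective⇒surjective {suc n} r r-inj u with any? (λ j → r j ≟ u)
... | yes hit = hit
... | no miss with pigeonhole ≤-refl (λ j → punchOut {i = u} {j = r j} (λ e → miss (j , sym e)))
...   | i , j , i<j , eq =
  ⊥-elim (<-irreflᶠ (r-inj (punchOut-injective (λ e → miss (i , sym e)) (λ e → miss (j , sym e)) eq)) i<j)

preimage : ∀ {m n} (e : Fin (suc m) → Fin n) → Inj e → (a : Fin n) → ∃ λ x → ∀ j → e j ≡ a → j ≡ x
preimage e e-inj a with any? (λ j → e j ≟ a)
... | yes (x , ex) = x , λ j ej → e-inj (trans ej (sym ex))
... | no none = zero , λ j ej → ⊥-elim (none (j , ej))

injective? : ∀ {m n} (f : Fin m → Fin n) → Dec (∀ i j → f i ≡ f j → i ≡ j)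
injective? f = all? λ i → all? λ j → (f i ≟ f j) →-dec (i ≟ j)

table-injective : ∀ {m n} (v : Vec (Fin n) m) → {True (injective? (lookup v))} → Inj (lookup v)
table-injective v {ok} eq = toWitness ok _ _ eq

pattern f0 = zero
pattern f1 = suc f0
pattern f2 = suc f1
pattern f3 = suc f2
pattern f4 = suc f3
pattern f5 = suc f4
pattern f6 = suc f5

Monochromatic3 : (Fin 5 → Bool) → Set
Monochromatic3 c = ∃ λ b → ∃ λ i → ∃ λ j → ∃ λ k → i ≢ j × i ≢ k × j ≢ k × c i ≡ b × c j ≡ b × c k ≡ b

-- Any two-colouring of five points has three points of the same colour: two of the first three
-- agree, and either the fourth or fifth point joins them or both join the remaining one.
majority5 : (c : Fin 5 → Bool) → Monochromatic3 c
majority5 c with c f0 in e0 | c f1 in e1 | c f2 in e2 | c f3 in e3 | c f4 in e4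
... | true  | true  | true  | _     | _     = true  , f0 , f1 , f2 , (λ ()) , (λ ()) , (λ ()) , e0 , e1 , e2
... | false | false | false | _     | _     = false , f0 , f1 , f2 , (λ ()) , (λ ()) , (λ ()) , e0 , e1 , e2
... | true  | true  | false | true  | _     = true  , f0 , f1 , f3 , (λ ()) , (λ ()) , (λ ()) , e0 , e1 , e3
... | true  | true  | false | false | true  = true  , f0 , f1 , f4 , (λ ()) , (λ ()) , (λ ()) , e0 , e1 , e4
... | true  | true  | false | false | false = false , f2 , f3 , f4 , (λ ()) , (λ ()) , (λ ()) , e2 , e3 , e4
... | false | false | true  | false | _     = false , f0 , f1 , f3 , (λ ()) , (λ ()) , (λ ()) , e0 , e1 , e3
... | false | false | true  | true  | false = false , f0 , f1 , f4 , (λ ()) , (λ ()) , (λ ()) , e0 , e1 , e4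
... | false | false | true  | true  | true  = true  , f2 , f3 , f4 , (λ ()) , (λ ()) , (λ ()) , e2 , e3 , e4
... | true  | false | true  | true  | _     = true  , f0 , f2 , f3 , (λ ()) , (λ ()) , (λ ()) , e0 , e2 , e3
... | true  | false | true  | false | true  = true  , f0 , f2 , f4 , (λ ()) , (λ ()) , (λ ()) , e0 , e2 , e4
... | true  | false | true  | false | false = false , f1 , f3 , f4 , (λ ()) , (λ ()) , (λ ()) , e1 , e3 , e4
... | false | true  | false | false | _     = false , f0 , f2 , f3 , (λ ()) , (λ ()) , (λ ()) , e0 , e2 , e3
... | false | true  | false | true  | false = false , f0 , f2 , f4 , (λ ()) , (λ ()) , (λ ()) , e0 , e2 , e4
... | false | true  | false | true  | true  = true  , f1 , f3 , f4 , (λ ()) , (λ ()) , (λ ()) , e1 , e3 , e4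
... | false | true  | true  | true  | _     = true  , f1 , f2 , f3 , (λ ()) , (λ ()) , (λ ()) , e1 , e2 , e3
... | false | true  | true  | false | true  = true  , f1 , f2 , f4 , (λ ()) , (λ ()) , (λ ()) , e1 , e2 , e4
... | false | true  | true  | false | false = false , f0 , f3 , f4 , (λ ()) , (λ ()) , (λ ()) , e0 , e3 , e4
... | true  | false | false | false | _     = false , f1 , f2 , f3 , (λ ()) , (λ ()) , (λ ()) , e1 , e2 , e3
... | true  | false | false | true  | false = false , f1 , f2 , f4 , (λ ()) , (λ ()) , (λ ()) , e1 , e2 , e4
... | true  | false | false | true  | true  = true  , f0 , f3 , f4 , (λ ()) , (λ ()) , (λ ()) , e0 , e3 , e4

adj⇒≢ : ∀ {n} (G : Graph n) {i j} → Adj G i j → i ≢ j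
adj⇒≢ G a refl = Adj-irr G a

module _ {n} (G : Graph (suc n)) (v : Fin (suc n)) where

  adjDeleteV : ∀ {u w} (v≢u : v ≢ u) (v≢w : v ≢ w) → Adj G u w →
               Adj (deleteV G v) (punchOut v≢u) (punchOut v≢w)
  adjDeleteV v≢u v≢w a = subst₂ (Adj G) (sym (punchIn-punchOut v≢u)) (sym (punchIn-punchOut v≢w)) a

  punchOut-≢ : ∀ {u w} (v≢u : v ≢ u) (v≢w : v ≢ w) → u ≢ w → punchOut v≢u ≢ punchOut v≢w
  punchOut-≢ v≢u v≢w u≢w e = u≢w (punchOut-injective v≢u v≢w e)

decAdj : ∀ {n} {G : Graph n} → TwoTree G → ∀ i j → Dec (Adj G i j)
decAdj (k3 G complete) i j with i ≟ j
... | yes refl = no (Adj-irr G)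
... | no i≢j   = yes (complete i j i≢j)
decAdj (ext G v (a , b , _ , va , vb , _ , cover) T) i j with v ≟ i | v ≟ j
... | yes refl | _ with j ≟ a | j ≟ b
...   | yes refl | _        = yes va
...   | no _     | yes refl = yes vb
...   | no j≢a   | no j≢b   = no λ vj → [ j≢a , j≢b ] (cover j vj)
decAdj (ext G v (a , b , _ , va , vb , _ , cover) T) i j | no _ | yes refl with i ≟ a | i ≟ b
...   | yes refl | _        = yes (Adj-sym G va)
...   | no _     | yes refl = yes (Adj-sym G vb)
...   | no i≢a   | no i≢b   = no λ iv → [ i≢a , i≢b ] (cover i (Adj-sym G iv))
decAdj (ext G v _ T) i j | no v≢i | no v≢j with decAdj T (punchOut v≢i) (punchOut v≢j)
... | yes a = yes (subst₂ (Adj G) (punchIn-punchOut v≢i) (punchIn-punchOut v≢j) a)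
... | no ¬a = no λ a → ¬a (adjDeleteV G v v≢i v≢j a)

triangleNbrs : (G : Graph 3) (u : Fin 3) → ∃₂ λ a b → ∀ w → Adj G u w → w ≡ a ⊎ w ≡ b
triangleNbrs G u =
  let (a , b , others) = othersInFin3 u in a , b , λ w uw → others w (λ e → adj⇒≢ G uw (sym e))

-- Degeneracy: every nonempty family X of vertices of a 2-tree has a member whose neighbours in the
-- family take at most two values.  (Peel off degree-2 vertices until a member of X is reached.)
degenerate : ∀ {n} {G : Graph n} → TwoTree G → ∀ {m} (X : Fin (suc m) → Fin n) →
             ∃ λ i → ∃₂ λ a b → ∀ j → Adj G (X i) (X j) → X j ≡ a ⊎ X j ≡ b
degenerate (k3 G _) X = let (a , b , nbrs) = triangleNbrs G (X zero) in zero , a , b , λ j → nbrs (X j)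
degenerate (ext {n′} G v (a , b , _ , _ , _ , _ , cover) T) {m} X with any? (λ j → X j ≟ v)
... | yes (i , refl) = i , a , b , λ j → cover (X j)
... | no miss =
  let (i , a′ , b′ , nbrs) = degenerate T X′ in
  i , punchIn v a′ , punchIn v b′ , λ j Xi~Xj → renumber j (nbrs j (adjDeleteV G v (v≢X i) (v≢X j) Xi~Xj))
  where
    v≢X : ∀ j → v ≢ X j
    v≢X j e = miss (j , sym e)
    X′ : Fin (suc m) → Fin n′
    X′ j = punchOut (v≢X j)
    renumber : ∀ j {a′ b′} → X′ j ≡ a′ ⊎ X′ j ≡ b′ → X j ≡ punchIn v a′ ⊎ X j ≡ punchIn v b′
    renumber j (inj₁ e) = inj₁ (trans (sym (punchIn-punchOut (v≢X j))) (cong (punchIn v) e))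
    renumber j (inj₂ e) = inj₂ (trans (sym (punchIn-punchOut (v≢X j))) (cong (punchIn v) e))

module _ {n} (G : Graph n) where

  MinDegree3 : ∀ {k} → (Fin k → Fin n) → Set
  MinDegree3 X = ∀ i → ∃ λ j₁ → ∃ λ j₂ → ∃ λ j₃ →
    X j₁ ≢ X j₂ × X j₁ ≢ X j₃ × X j₂ ≢ X j₃ ×
    Adj G (X i) (X j₁) × Adj G (X i) (X j₂) × Adj G (X i) (X j₃)

noMinDegree3 : ∀ {n} {G : Graph n} → TwoTree G → ∀ {m} (X : Fin (suc m) → Fin n) → ¬ MinDegree3 G X
noMinDegree3 T X minDeg with degenerate T X
... | i , a , b , nbrs with minDeg i
...   | _ , _ , _ , d₁₂ , d₁₃ , d₂₃ , a₁ , a₂ , a₃ = noThreeInPair X nbrs d₁₂ d₁₃ d₂₃ a₁ a₂ a₃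

module _ {n} {G : Graph n} (T : TwoTree G) where

  noK4 : ∀ {a b c d} → Adj G a b → Adj G a c → Adj G a d → Adj G b c → Adj G b d → Adj G c d → ⊥
  noK4 {a} {b} {c} {d} ab ac ad bc bd cd = noMinDegree3 T (lookup (a ∷ b ∷ c ∷ d ∷ [])) minDeg
    where
      ≠ : ∀ {x y} → Adj G x y → x ≢ y
      ≠ = adj⇒≢ G
      sy : ∀ {x y} → Adj G x y → Adj G y x
      sy = Adj-sym G
      minDeg : MinDegree3 G (lookup (a ∷ b ∷ c ∷ d ∷ []))
      minDeg f0 = f1 , f2 , f3 , ≠ bc , ≠ bd , ≠ cd , ab , ac , ad
      minDeg f1 = f0 , f2 , f3 , ≠ ac , ≠ ad , ≠ cd , sy ab , bc , bd
      minDeg f2 = f0 , f1 , f3 , ≠ ab , ≠ ad , ≠ bd , sy ac , sy bc , cd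
      minDeg f3 = f0 , f1 , f2 , ≠ ab , ≠ ac , ≠ bc , sy ad , sy bd , sy cd

  noK33 : ∀ {a₁ a₂ a₃ b₁ b₂ b₃} →
          a₁ ≢ a₂ → a₁ ≢ a₃ → a₂ ≢ a₃ → b₁ ≢ b₂ → b₁ ≢ b₃ → b₂ ≢ b₃ →
          Adj G a₁ b₁ → Adj G a₁ b₂ → Adj G a₁ b₃ →
          Adj G a₂ b₁ → Adj G a₂ b₂ → Adj G a₂ b₃ →
          Adj G a₃ b₁ → Adj G a₃ b₂ → Adj G a₃ b₃ → ⊥
  noK33 {a₁} {a₂} {a₃} {b₁} {b₂} {b₃} d₁₂ d₁₃ d₂₃ e₁₂ e₁₃ e₂₃ x₁₁ x₁₂ x₁₃ x₂₁ x₂₂ x₂₃ x₃₁ x₃₂ x₃₃ =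
    noMinDegree3 T (lookup (a₁ ∷ a₂ ∷ a₃ ∷ b₁ ∷ b₂ ∷ b₃ ∷ [])) minDeg
    where
      sy : ∀ {x y} → Adj G x y → Adj G y x
      sy = Adj-sym G
      minDeg : MinDegree3 G (lookup (a₁ ∷ a₂ ∷ a₃ ∷ b₁ ∷ b₂ ∷ b₃ ∷ []))
      minDeg f0 = f3 , f4 , f5 , e₁₂ , e₁₃ , e₂₃ , x₁₁ , x₁₂ , x₁₃
      minDeg f1 = f3 , f4 , f5 , e₁₂ , e₁₃ , e₂₃ , x₂₁ , x₂₂ , x₂₃
      minDeg f2 = f3 , f4 , f5 , e₁₂ , e₁₃ , e₂₃ , x₃₁ , x₃₂ , x₃₃
      minDeg f3 = f0 , f1 , f2 , d₁₂ , d₁₃ , d₂₃ , sy x₁₁ , sy x₂₁ , sy x₃₁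
      minDeg f4 = f0 , f1 , f2 , d₁₂ , d₁₃ , d₂₃ , sy x₁₂ , sy x₂₂ , sy x₃₂
      minDeg f5 = f0 , f1 , f2 , d₁₂ , d₁₃ , d₂₃ , sy x₁₃ , sy x₂₃ , sy x₃₃

-- If two distinct vertices p, q of a 2-tree have common neighbours a, b, c with a, b ≠ c, then a and b
-- are not adjacent.  (Otherwise, at the moment c is peeled off its two neighbours are p and q, which are
-- therefore adjacent, and p, q, a, b form a K₄.)
commonNbrsIndependent : ∀ {n} {G : Graph n} → TwoTree G → ∀ {p q a b c} → p ≢ q → a ≢ c → b ≢ c →
  Adj G p a → Adj G p b → Adj G p c → Adj G q a → Adj G q b → Adj G q c → ¬ Adj G a b
commonNbrsIndependent (k3 G _) {p} p≢q a≢c b≢c pa pb pc _ _ _ ab =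
  let (_ , _ , nbrs) = triangleNbrs G p in noThreeInPair (λ w → w) nbrs (adj⇒≢ G ab) a≢c b≢c pa pb pc
commonNbrsIndependent T′@(ext G v (x , y , x≢y , _ , _ , xy , cover) T) {p} {q} {a} {b} {c}
  p≢q a≢c b≢c pa pb pc qa qb qc ab
  with v ≟ p | v ≟ q | v ≟ a | v ≟ b | v ≟ c
... | yes refl | _ | _ | _ | _ = noThreeInPair (λ w → w) cover (adj⇒≢ G ab) a≢c b≢c pa pb pc
... | no _ | yes refl | _ | _ | _ = noThreeInPair (λ w → w) cover (adj⇒≢ G ab) a≢c b≢c qa qb qc
... | no _ | no _ | yes refl | _ | _ =
  noThreeInPair (λ w → w) cover p≢q (adj⇒≢ G pb) (adj⇒≢ G qb) (Adj-sym G pa) (Adj-sym G qa) ab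
... | no _ | no _ | no _ | yes refl | _ =
  noThreeInPair (λ w → w) cover p≢q (adj⇒≢ G pa) (adj⇒≢ G qa) (Adj-sym G pb) (Adj-sym G qb) (Adj-sym G ab)
... | no _ | no _ | no _ | no _ | yes refl =
  noK4 T′ (bothNbrsAdjacent (cover p (Adj-sym G pc)) (cover q (Adj-sym G qc))) pa pb qa qb ab
  where
    -- the two distinct neighbours p, q of c are its neighbours x, y, which are adjacent
    bothNbrsAdjacent : p ≡ x ⊎ p ≡ y → q ≡ x ⊎ q ≡ y → Adj G p q
    bothNbrsAdjacent (inj₁ refl) (inj₁ refl) = ⊥-elim (p≢q refl)
    bothNbrsAdjacent (inj₁ refl) (inj₂ refl) = xy
    bothNbrsAdjacent (inj₂ refl) (inj₁ refl) = Adj-sym G xy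
    bothNbrsAdjacent (inj₂ refl) (inj₂ refl) = ⊥-elim (p≢q refl)
... | no v≢p | no v≢q | no v≢a | no v≢b | no v≢c =
  commonNbrsIndependent T (punchOut-≢ G v v≢p v≢q p≢q) (punchOut-≢ G v v≢a v≢c a≢c) (punchOut-≢ G v v≢b v≢c b≢c)
    (adjDeleteV G v v≢p v≢a pa) (adjDeleteV G v v≢p v≢b pb) (adjDeleteV G v v≢p v≢c pc)
    (adjDeleteV G v v≢q v≢a qa) (adjDeleteV G v v≢q v≢b qb) (adjDeleteV G v v≢q v≢c qc)
    (adjDeleteV G v v≢a v≢b ab)

double-suc : ∀ k → 2 * suc k ≡ 2 + 2 * k
double-suc = solve-∀

-- The missing edge of G(3t+4) is the missing edge of G(3t+1) moved up by two (t = 2 + k).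
missing-up : ∀ k d → 1 ≤ d → d ≤ 3 → 2 * (3 + k) ∸ d ≡ 2 + (2 * (2 + k) ∸ d)
missing-up k d 1≤d d≤3 = begin
  2 * (3 + k) ∸ d   ≡⟨ cong (_∸ d) (double₃ k) ⟩
  (2 + (4 + 2 * k)) ∸ d ≡⟨ +-∸-assoc 2 (≤-trans d≤3 (m≤m+n 3 _)) ⟩
  2 + ((4 + 2 * k) ∸ d) ≡⟨ cong (λ z → 2 + (z ∸ d)) (sym (double₂ k)) ⟩
  2 + (2 * (2 + k) ∸ d) ∎
  where
    open ≡-Reasoning
    double₂ : ∀ k → 2 * (2 + k) ≡ 4 + 2 * k
    double₂ = solve-∀
    double₃ : ∀ k → 2 * (3 + k) ≡ 2 + (4 + 2 * k)
    double₃ = solve-∀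

v-not-above : ∀ t {a} → a < 2 * t + 1 → 2 * t < a → ⊥
v-not-above t {a} a<2t+1 2t<a = <-irrefl refl (≤-trans 2t<a (≤-pred (subst (suc a ≤_) (+-comm (2 * t) 1) a<2t+1)))

x-above : ∀ t {i b} → 1 ≤ i → b ≡ 2 * t + i → 2 * t < b
x-above t {suc i} (s≤s z≤n) refl = subst (2 * t <_) (sym (+-suc (2 * t) i)) (s≤s (m≤m+n (2 * t) i))

x-not-below : ∀ t {i b} → 1 ≤ i → b ≡ 2 * t + i → b ≤ 2 * t → ⊥
x-not-below t 1≤i b≡ b≤2t = <-irrefl refl (≤-trans (x-above t 1≤i b≡) b≤2t)

x-index : ∀ t b → 2 * t < b → b < 3 * t + 1 → ∃ λ i → 1 ≤ i × i ≤ t × b ≡ 2 * t + i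
x-index t b 2t<b b<3t+1 with m≤n⇒∃[o]m+o≡n 2t<b
... | o , eq = suc o , s≤s z≤n , o<t , trans (sym eq) (sym (+-suc (2 * t) o))
  where
    size₁ : ∀ t o → suc (suc (2 * t + o)) ≡ 2 * t + suc (suc o)
    size₁ = solve-∀
    size₂ : ∀ t → 3 * t + 1 ≡ 2 * t + suc t
    size₂ = solve-∀
    o<t : suc o ≤ t
    o<t = ≤-pred (+-cancelˡ-≤ (2 * t) _ _
            (subst₂ _≤_ (trans (cong suc (sym eq)) (size₁ t o)) (size₂ t) b<3t+1))

-- Passing from G(3t+1) to G(3t+4) renumbers the old vertices: v_a becomes v_{a+2} (index + 2) and x_i
-- becomes x_{i+1} (index + 3); v₁, v₂ and x₁ of the larger graph are new.
data Shift (t : ℕ) : ℕ → ℕ → Set where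
  shift-v : ∀ {a} → a ≤ 2 * t → Shift t a (2 + a)
  shift-x : ∀ {a} → 2 * t < a → Shift t a (3 + a)

shift-functional : ∀ {t a n n′} → Shift t a n → Shift t a n′ → n ≡ n′
shift-functional (shift-v _) (shift-v _) = refl
shift-functional (shift-v a≤) (shift-x <a) = ⊥-elim (<-irrefl refl (≤-trans (s≤s a≤) <a))
shift-functional (shift-x <a) (shift-v a≤) = ⊥-elim (<-irrefl refl (≤-trans (s≤s a≤) <a))
shift-functional (shift-x _) (shift-x _) = refl

v-up : ∀ t {a} → a < 2 * t + 1 → 2 + a < 2 * suc t + 1
v-up t {a} a< = subst (λ z → 2 + a < z + 1) (sym (double-suc t)) (s≤s (s≤s a<))

nbr-up : ∀ i {a} → a < 2 * i → 2 + a < 2 * suc i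
nbr-up i {a} a< = subst (2 + a <_) (sym (double-suc i)) (s≤s (s≤s a<))

x-up : ∀ t i {b} → b ≡ 2 * t + i → 3 + b ≡ 2 * suc t + suc i
x-up t i refl = lemma t i
  where lemma : ∀ t i → 3 + (2 * t + i) ≡ 2 * suc t + suc i
        lemma = solve-∀

-- The renumbering maps edges of G(3t+1) to edges of G(3t+4), for t ≥ 2: all v's and the missing edge
-- move up by two, and x_i's neighbourhood v₁..v_{2i} lands inside x_{i+1}'s neighbourhood v₁..v_{2i+2}.
shift-edge : ∀ k {a b a′ b′} → GE (2 + k) a b → Shift (2 + k) a a′ → Shift (2 + k) b b′ → GE (3 + k) a′ b′
shift-edge k (vv a< b< a≢b ¬m₁ ¬m₂) (shift-v _) (shift-v _) =
  vv (v-up (2 + k) a<) (v-up (2 + k) b<) (λ e → a≢b (suc-injective (suc-injective e)))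
     (λ { (e₁ , e₂) → ¬m₁ (down₁ e₁ , down₂ e₂) })
     (λ { (e₁ , e₂) → ¬m₂ (down₂ e₁ , down₁ e₂) })
  where
    down₁ : ∀ {a} → 2 + a ≡ 2 * (3 + k) ∸ 3 → a ≡ 2 * (2 + k) ∸ 3
    down₁ e = suc-injective (suc-injective (trans e (missing-up k 3 (s≤s z≤n) ≤-refl)))
    down₂ : ∀ {a} → 2 + a ≡ 2 * (3 + k) ∸ 1 → a ≡ 2 * (2 + k) ∸ 1
    down₂ e = suc-injective (suc-injective (trans e (missing-up k 1 ≤-refl (s≤s z≤n))))
shift-edge k (vv a< _ _ _ _) (shift-x above) _ = ⊥-elim (v-not-above (2 + k) a< above)
shift-edge k (vv _ b< _ _ _) (shift-v _) (shift-x above) = ⊥-elim (v-not-above (2 + k) b< above)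
shift-edge k (vx i a< _ i≤t a<2i b≡) (shift-v _) (shift-x _) =
  vx (suc i) (v-up (2 + k) a<) (s≤s z≤n) (s≤s i≤t) (nbr-up i a<2i) (x-up (2 + k) i b≡)
shift-edge k (vx i a< _ _ _ _) (shift-x above) _ = ⊥-elim (v-not-above (2 + k) a< above)
shift-edge k (vx i _ 1≤i _ _ b≡) (shift-v _) (shift-v b≤) = ⊥-elim (x-not-below (2 + k) 1≤i b≡ b≤)
shift-edge k (xv i a< _ i≤t a<2i b≡) (shift-x _) (shift-v _) =
  xv (suc i) (v-up (2 + k) a<) (s≤s z≤n) (s≤s i≤t) (nbr-up i a<2i) (x-up (2 + k) i b≡)
shift-edge k (xv i a< _ _ _ _) _ (shift-x above) = ⊥-elim (v-not-above (2 + k) a< above)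
shift-edge k (xv i _ 1≤i _ _ b≡) (shift-v b≤) (shift-v _) = ⊥-elim (x-not-below (2 + k) 1≤i b≡ b≤)

-- In G(3t+1) with t ≥ 3 the vertices v₁ and v₂ (indices 0 and 1) are adjacent to every other vertex:
-- they lie in every x-neighbourhood and, as the missing edge sits at indices ≥ 2, in every v-edge.
front-universal : ∀ k {a} b → a < 2 → b < 3 * (3 + k) + 1 → a ≢ b → GE (3 + k) a b
front-universal k {a} b a<2 b< a≢b with b ≤? 2 * (3 + k)
... | yes b≤ =
  vv (≤-trans a<2 (s≤s (s≤s z≤n))) (subst (suc b ≤_) (+-comm 1 (2 * (3 + k))) (s≤s b≤)) a≢b
     (λ { (e , _) → far 3 (s≤s z≤n) ≤-refl e }) (λ { (e , _) → far 1 ≤-refl (s≤s z≤n) e })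
  where
    far : ∀ d → 1 ≤ d → d ≤ 3 → a ≢ 2 * (3 + k) ∸ d
    far d 1≤d d≤3 e = <-irrefl refl (≤-trans a<2 (subst (2 ≤_) (sym (trans e (missing-up k d 1≤d d≤3))) (m≤m+n 2 _)))
... | no b≰ with x-index (3 + k) b (≰⇒> b≰) b<
...   | i , 1≤i , i≤t , b≡ = vx i (≤-trans a<2 (s≤s (s≤s z≤n))) 1≤i i≤t (≤-trans a<2 (2≤double 1≤i)) b≡
  where
    2≤double : ∀ {i} → 1 ≤ i → 2 ≤ 2 * i
    2≤double {suc i} _ = s≤s (subst (1 ≤_) (sym (+-suc i (i + 0))) (s≤s z≤n))

x₁-front : ∀ k b → b < 2 → GE (3 + k) (2 * (3 + k) + 1) b
x₁-front k b b<2 = xv 1 (≤-trans b<2 (s≤s (s≤s z≤n))) (s≤s z≤n) (s≤s z≤n) b<2 refl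

data NewIndex (k n : ℕ) : Set where
  is-v₁ : n ≡ 0 → NewIndex k n
  is-v₂ : n ≡ 1 → NewIndex k n
  is-x₁ : n ≡ 2 * (3 + k) + 1 → NewIndex k n
  is-old : (j : Fin (3 * (2 + k) + 1)) → Shift (2 + k) (toℕ j) n → NewIndex k n

newIndex : ∀ k n → n < 3 * (3 + k) + 1 → NewIndex k n
newIndex k zero _ = is-v₁ refl
newIndex k (suc zero) _ = is-v₂ refl
newIndex k (suc (suc m)) n< with m ≤? 2 * (2 + k)
... | yes m≤ = is-old (fromℕ< m<) (subst (λ z → Shift (2 + k) z (2 + m)) (sym (toℕ-fromℕ< m<)) (shift-v m≤))
  where
    bound : ∀ k → suc (2 * (2 + k) + (2 + k)) ≡ 3 * (2 + k) + 1
    bound = solve-∀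
    m< : m < 3 * (2 + k) + 1
    m< = ≤-trans (s≤s m≤) (subst (suc (2 * (2 + k)) ≤_) (bound k) (s≤s (m≤m+n (2 * (2 + k)) (2 + k))))
... | no m≰ with m ≟ℕ (2 * (2 + k) + 1)
...   | yes refl = is-x₁ (lemma k)
  where lemma : ∀ k → 2 + (2 * (2 + k) + 1) ≡ 2 * (3 + k) + 1
        lemma = solve-∀
...   | no m≢ with m
...     | zero = ⊥-elim (m≰ z≤n)
...     | suc m₁ = is-old (fromℕ< m₁<) (subst (λ z → Shift (2 + k) z (3 + m₁)) (sym (toℕ-fromℕ< m₁<)) (shift-x above))
  where
    above : 2 * (2 + k) < m₁
    above = ≤∧≢⇒< (≤-pred (≰⇒> m≰)) (λ e → m≢ (trans (cong suc (sym e)) (+-comm 1 (2 * (2 + k)))))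
    size : ∀ k → 3 * (3 + k) + 1 ≡ 3 + (3 * (2 + k) + 1)
    size = solve-∀
    m₁< : m₁ < 3 * (2 + k) + 1
    m₁< = ≤-pred (≤-pred (≤-pred (subst (suc (3 + m₁) ≤_) (size k) n<)))

module Embedding {N} (G : Graph N) where

  record Pivot {M} (e : Fin M → Fin N) : Set where
    field
      s p q : Fin M
      p≢q   : p ≢ q
      s≢p   : s ≢ p
      s≢q   : s ≢ q
      nbrs  : ∀ j → Adj G (e s) (e j) → j ≡ p ⊎ j ≡ q

  -- The members of the family other than s, p and q.  (This and pivot are abstract: only their
  -- specifications matter, and unfolding them makes type checking slow.)
  abstract
    others : ∀ {m} {e : Fin (3 + m) → Fin N} (π : Pivot e) → Complement3 (Pivot.s π) (Pivot.p π) (Pivot.q π)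
    others π = complement3 s p q s≢p s≢q p≢q
      where open Pivot π

  -- Every injective family of at least three vertices of a 2-tree has a pivot: degeneracy gives a member
  -- with at most two neighbour values, which we pad to two distinct slots.
  abstract
    pivot : TwoTree G → ∀ {m} (e : Fin (3 + m) → Fin N) → Inj e → Pivot e
    pivot T e e-inj with degenerate T e
    ... | i , a , b , nbrs with preimage e e-inj a | preimage e e-inj b
    ...   | x , only-x | y , only-y
      with twoDistinctSlots {A = λ j → Adj G (e i) (e j)} i x y
             (λ j ij → Sum.map (only-x j) (only-y j) (nbrs j ij)) (Adj-irr G)
    ...     | p , q , p≢q , i≢p , i≢q , cover =
      record { s = i ; p = p ; q = q ; p≢q = p≢q ; s≢p = i≢p ; s≢q = i≢q ; nbrs = cover }

  restrictPivot : ∀ {M m} {e : Fin M → Fin N} (g : Fin m → Fin M) → Inj g → (π : Pivot e) →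
                  let open Pivot π in
                  (∃ λ y → g y ≡ s) → (∃ λ y → g y ≡ p) → (∃ λ y → g y ≡ q) → Pivot (e ∘ g)
  restrictPivot {e = e} g g-inj π (ys , g-ys) (yp , g-yp) (yq , g-yq) = record
    { s = ys ; p = yp ; q = yq
    ; p≢q = λ eq → p≢q (trans (sym g-yp) (trans (cong g eq) g-yq))
    ; s≢p = λ eq → s≢p (trans (sym g-ys) (trans (cong g eq) g-yp))
    ; s≢q = λ eq → s≢q (trans (sym g-ys) (trans (cong g eq) g-yq))
    ; nbrs = λ j a → Sum.map (λ eq → g-inj (trans eq (sym g-yp))) (λ eq → g-inj (trans eq (sym g-yq)))
                             (nbrs (g j) (subst (λ z → Adj G (e z) (e (g j))) g-ys a)) }
    where open Pivot π

  record Placement (k : ℕ) {M} (e : Fin M → Fin N) : Set where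
    field
      at           : Fin (3 * k + 1) → Fin N
      at-injective : Inj at
      at-member    : ∀ j → ∃ λ i → at j ≡ e i
      at-edges     : ∀ j j′ → Adj G (at j) (at j′) → GE k (toℕ j) (toℕ j′)

  -- The induction step (t = 2 + k ≥ 2): if the family minus a pivot s and its slots p, q is placed in
  -- G(3t+1), the whole family is placed in G(3t+4) by putting p, q at v₁, v₂, s at x₁, and renumbering
  -- the old placement.  v₁, v₂ are adjacent to everything and x₁ to v₁, v₂, which are all edges s can have.
  module _ (k : ℕ) {m} (e : Fin (3 + m) → Fin N) (e-inj : Inj e) (π : Pivot e) where
    open Pivot π
    open Complement3 (others π)

    extend : Placement (2 + k) (e ∘ elem) → Placement (3 + k) e
    extend P = record
      { at = λ j → e (origin (classify j))
      ; at-injective = λ {j} {j′} eq → toℕ-injective (origin-injective (classify j) (classify j′) (e-inj eq))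
      ; at-member = λ j → origin (classify j) , refl
      ; at-edges = λ j j′ a → edges (classify j) (classify j′) (toℕ<n j) (toℕ<n j′)
          (λ n≡n′ → Adj-irr G (subst (λ z → Adj G (e (origin (classify j))) (e (origin (classify z))))
                                     (sym (toℕ-injective n≡n′)) a)) a
      }
      where
        open Placement P renaming (at to at₀; at-injective to at₀-injective; at-member to at₀-member; at-edges to at₀-edges)

        classify : (j : Fin (3 * (3 + k) + 1)) → NewIndex k (toℕ j)
        classify j = newIndex k (toℕ j) (toℕ<n j)

        old : Fin (3 * (2 + k) + 1) → Fin m
        old j = proj₁ (at₀-member j)

        origin : ∀ {n} → NewIndex k n → Fin (3 + m)
        origin (is-v₁ _)   = p
        origin (is-v₂ _)   = q
        origin (is-x₁ _)   = s
        origin (is-old j _) = elem (old j)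

        origin-injective : ∀ {n n′} (v : NewIndex k n) (v′ : NewIndex k n′) → origin v ≡ origin v′ → n ≡ n′
        origin-injective (is-v₁ a) (is-v₁ b) _ = trans a (sym b)
        origin-injective (is-v₂ a) (is-v₂ b) _ = trans a (sym b)
        origin-injective (is-x₁ a) (is-x₁ b) _ = trans a (sym b)
        origin-injective (is-old j u) (is-old j′ u′) eq with at₀-injective (begin
            at₀ j             ≡⟨ proj₂ (at₀-member j) ⟩
            e (elem (old j))  ≡⟨ cong e eq ⟩
            e (elem (old j′)) ≡⟨ sym (proj₂ (at₀-member j′)) ⟩
            at₀ j′ ∎)
          where open ≡-Reasoning
        ... | refl = shift-functional u u′
        origin-injective (is-v₁ _) (is-v₂ _) eq = ⊥-elim (p≢q eq)
        origin-injective (is-v₁ _) (is-x₁ _) eq = ⊥-elim (s≢p (sym eq))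
        origin-injective (is-v₂ _) (is-v₁ _) eq = ⊥-elim (p≢q (sym eq))
        origin-injective (is-v₂ _) (is-x₁ _) eq = ⊥-elim (s≢q (sym eq))
        origin-injective (is-x₁ _) (is-v₁ _) eq = ⊥-elim (s≢p eq)
        origin-injective (is-x₁ _) (is-v₂ _) eq = ⊥-elim (s≢q eq)
        origin-injective (is-v₁ _) (is-old j _) eq = ⊥-elim (avoids-b (old j) (sym eq))
        origin-injective (is-v₂ _) (is-old j _) eq = ⊥-elim (avoids-c (old j) (sym eq))
        origin-injective (is-x₁ _) (is-old j _) eq = ⊥-elim (avoids-a (old j) (sym eq))
        origin-injective (is-old j _) (is-v₁ _) eq = ⊥-elim (avoids-b (old j) eq)
        origin-injective (is-old j _) (is-v₂ _) eq = ⊥-elim (avoids-c (old j) eq)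
        origin-injective (is-old j _) (is-x₁ _) eq = ⊥-elim (avoids-a (old j) eq)

        s≁old : ∀ j → ¬ Adj G (e s) (e (elem (old j)))
        s≁old j a with nbrs (elem (old j)) a
        ... | inj₁ eq = avoids-b (old j) eq
        ... | inj₂ eq = avoids-c (old j) eq

        edges : ∀ {n n′} (v : NewIndex k n) (v′ : NewIndex k n′) → n < 3 * (3 + k) + 1 → n′ < 3 * (3 + k) + 1 →
                n ≢ n′ → Adj G (e (origin v)) (e (origin v′)) → GE (3 + k) n n′
        edges (is-v₁ refl) _ _ n′< n≢n′ _ = front-universal k _ (s≤s z≤n) n′< n≢n′
        edges (is-v₂ refl) _ _ n′< n≢n′ _ = front-universal k _ (s≤s (s≤s z≤n)) n′< n≢n′
        edges (is-x₁ refl) (is-v₁ refl) _ _ _ _ = x₁-front k 0 (s≤s z≤n)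
        edges (is-x₁ refl) (is-v₂ refl) _ _ _ _ = x₁-front k 1 (s≤s (s≤s z≤n))
        edges (is-x₁ refl) (is-x₁ refl) _ _ n≢n′ _ = ⊥-elim (n≢n′ refl)
        edges (is-x₁ refl) (is-old j _) _ _ _ a = ⊥-elim (s≁old j a)
        edges (is-old j _) (is-v₁ refl) n< _ n≢n′ _ = GE-sym (front-universal k _ (s≤s z≤n) n< (λ e → n≢n′ (sym e)))
        edges (is-old j _) (is-v₂ refl) n< _ n≢n′ _ = GE-sym (front-universal k _ (s≤s (s≤s z≤n)) n< (λ e → n≢n′ (sym e)))
        edges (is-old j _) (is-x₁ refl) _ _ _ a = ⊥-elim (s≁old j (Adj-sym G a))
        edges (is-old j u) (is-old j′ u′) _ _ _ a =
          shift-edge k (at₀-edges j j′ (subst₂ (Adj G) (sym (proj₂ (at₀-member j))) (sym (proj₂ (at₀-member j′))) a)) u u′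

vv! : ∀ a b → {True (a <? 5)} → {True (b <? 5)} → {False (a ≟ℕ b)} →
      {False ((a ≟ℕ 1) ×-dec (b ≟ℕ 3))} → {False ((a ≟ℕ 3) ×-dec (b ≟ℕ 1))} → GE 2 a b
vv! a b {p₁} {p₂} {p₃} {p₄} {p₅} =
  vv (toWitness p₁) (toWitness p₂) (toWitnessFalse p₃) (toWitnessFalse p₄) (toWitnessFalse p₅)

vx! : ∀ a i → {True (a <? 5)} → {True (1 ≤? i)} → {True (i ≤? 2)} → {True (a <? 2 * i)} → GE 2 a (4 + i)
vx! a i {p₁} {p₂} {p₃} {p₄} = vx i (toWitness p₁) (toWitness p₂) (toWitness p₃) (toWitness p₄) refl

xv! : ∀ a i → {True (a <? 5)} → {True (1 ≤? i)} → {True (i ≤? 2)} → {True (a <? 2 * i)} → GE 2 (4 + i) a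
xv! a i {p₁} {p₂} {p₃} {p₄} = xv i (toWitness p₁) (toWitness p₂) (toWitness p₃) (toWitness p₄) refl

module _ {N} (G : Graph N) where
  open Embedding G

  -- G(7) has vertices v₁..v₅ = 0..4, complete except v₂v₄, and x₁ = 5 ~ v₁, v₂, x₂ = 6 ~ v₁..v₄.
  g7-placement : ∀ {M} (e : Fin M → Fin N) (d : Fin 7 → Fin N) → Inj d → (∀ j → ∃ λ i → d j ≡ e i) →
                 (∀ j → Adj G (d f5) (d j) → j ≡ f0 ⊎ j ≡ f1) →
                 ¬ Adj G (d f6) (d f4) → ¬ Adj G (d f1) (d f3) → Placement 2 e
  g7-placement e d d-inj d-member x₁-nbrs ¬64 ¬13 =
    record { at = d ; at-injective = d-inj ; at-member = d-member ; at-edges = edges }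
    where
      x₁-row : ∀ j → j ≡ f0 ⊎ j ≡ f1 → GE 2 5 (toℕ j)
      x₁-row _ (inj₁ refl) = xv! 0 1
      x₁-row _ (inj₂ refl) = xv! 1 1
      edges : ∀ j j′ → Adj G (d j) (d j′) → GE 2 (toℕ j) (toℕ j′)
      edges f5 j a = x₁-row j (x₁-nbrs j a)
      edges j f5 a = GE-sym (x₁-row j (x₁-nbrs j (Adj-sym G a)))
      edges f0 f0 a = ⊥-elim (Adj-irr G a)
      edges f0 f1 _ = vv! 0 1
      edges f0 f2 _ = vv! 0 2
      edges f0 f3 _ = vv! 0 3
      edges f0 f4 _ = vv! 0 4
      edges f0 f6 _ = vx! 0 2
      edges f1 f0 _ = vv! 1 0
      edges f1 f1 a = ⊥-elim (Adj-irr G a)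
      edges f1 f2 _ = vv! 1 2
      edges f1 f3 a = ⊥-elim (¬13 a)
      edges f1 f4 _ = vv! 1 4
      edges f1 f6 _ = vx! 1 2
      edges f2 f0 _ = vv! 2 0
      edges f2 f1 _ = vv! 2 1
      edges f2 f2 a = ⊥-elim (Adj-irr G a)
      edges f2 f3 _ = vv! 2 3
      edges f2 f4 _ = vv! 2 4
      edges f2 f6 _ = vx! 2 2
      edges f3 f0 _ = vv! 3 0
      edges f3 f1 a = ⊥-elim (¬13 (Adj-sym G a))
      edges f3 f2 _ = vv! 3 2
      edges f3 f3 a = ⊥-elim (Adj-irr G a)
      edges f3 f4 _ = vv! 3 4
      edges f3 f6 _ = vx! 3 2
      edges f4 f0 _ = vv! 4 0
      edges f4 f1 _ = vv! 4 1
      edges f4 f2 _ = vv! 4 2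
      edges f4 f3 _ = vv! 4 3
      edges f4 f4 a = ⊥-elim (Adj-irr G a)
      edges f4 f6 a = ⊥-elim (¬64 (Adj-sym G a))
      edges f6 f0 _ = xv! 0 2
      edges f6 f1 _ = xv! 1 2
      edges f6 f2 _ = xv! 2 2
      edges f6 f3 _ = xv! 3 2
      edges f6 f4 a = ⊥-elim (¬64 a)
      edges f6 f6 a = ⊥-elim (Adj-irr G a)

module SevenVertices {N} {G : Graph N} (T : TwoTree G) {e₁ : Fin 7 → Fin N} (e₁-inj : Inj e₁) where
  open Embedding G

  A : Fin N → Fin N → Set
  A = Adj G

  record Frame : Set where
    field
      pivot₀  : Pivot e₁
      others₀ : Complement3 (Pivot.s pivot₀) (Pivot.p pivot₀) (Pivot.q pivot₀)
    open Pivot pivot₀ public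
    open Complement3 others₀ public renaming (elem to w)
    S P Q : Fin N
    S = e₁ s
    P = e₁ p
    Q = e₁ q
    W : Fin 4 → Fin N
    W i = e₁ (w i)

  frameOf : Pivot e₁ → Frame
  frameOf π = record { pivot₀ = π ; others₀ = others π }

  reorder : Frame → (ρ : Vec (Fin 4) 4) → {True (injective? (lookup ρ))} → Frame
  reorder F ρ {ok} = record
    { pivot₀ = pivot₀
    ; others₀ = record
      { elem = w ∘ lookup ρ
      ; injective = λ eq → table-injective ρ {ok} (injective eq)
      ; avoids-a = avoids-a ∘ lookup ρ ; avoids-b = avoids-b ∘ lookup ρ ; avoids-c = avoids-c ∘ lookup ρ
      ; onto = λ x x≢s x≢p x≢q →
          let (y , wy≡x) = onto x x≢s x≢p x≢q
              (z , ρz≡y) = injective⇒surjective (lookup ρ) (table-injective ρ {ok}) y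
          in z , trans (cong w ρz≡y) wy≡x
      } }
    where open Frame F

  swapPQ : Frame → Frame
  swapPQ F = record
    { pivot₀ = record { s = s ; p = q ; q = p ; p≢q = λ e → p≢q (sym e) ; s≢p = s≢q ; s≢q = s≢p
                      ; nbrs = λ j a → Sum.swap (nbrs j a) }
    ; others₀ = record { elem = w ; injective = injective ; avoids-a = avoids-a
                       ; avoids-b = avoids-c ; avoids-c = avoids-b
                       ; onto = λ x x≢s x≢p x≢q → onto x x≢s x≢q x≢p } }
    where open Frame F

  module _ (F : Frame) where
    open Frame F

    listing : Fin 7 → Fin 7
    listing f0 = s
    listing f1 = p
    listing f2 = q
    listing (suc (suc (suc i))) = w i

    listing-injective : Inj listing
    listing-injective {f0} {f0} _ = refl
    listing-injective {f0} {f1} e = ⊥-elim (s≢p e)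
    listing-injective {f0} {f2} e = ⊥-elim (s≢q e)
    listing-injective {f0} {suc (suc (suc j))} e = ⊥-elim (avoids-a j (sym e))
    listing-injective {f1} {f0} e = ⊥-elim (s≢p (sym e))
    listing-injective {f1} {f1} _ = refl
    listing-injective {f1} {f2} e = ⊥-elim (p≢q e)
    listing-injective {f1} {suc (suc (suc j))} e = ⊥-elim (avoids-b j (sym e))
    listing-injective {f2} {f0} e = ⊥-elim (s≢q (sym e))
    listing-injective {f2} {f1} e = ⊥-elim (p≢q (sym e))
    listing-injective {f2} {f2} _ = refl
    listing-injective {f2} {suc (suc (suc j))} e = ⊥-elim (avoids-c j (sym e))
    listing-injective {suc (suc (suc i))} {f0} e = ⊥-elim (avoids-a i e)
    listing-injective {suc (suc (suc i))} {f1} e = ⊥-elim (avoids-b i e)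
    listing-injective {suc (suc (suc i))} {f2} e = ⊥-elim (avoids-c i e)
    listing-injective {suc (suc (suc i))} {suc (suc (suc j))} e = cong (λ k → suc (suc (suc k))) (injective e)

  SeesBoth : Fin N → Fin N → Fin N → Set
  SeesBoth u v x = A x u × A x v

  commonNbrs-≁ : ∀ {u v x y z} → u ≢ v → x ≢ z → y ≢ z →
                 SeesBoth u v x → SeesBoth u v y → SeesBoth u v z → ¬ A x y
  commonNbrs-≁ u≢v x≢z y≢z (x~u , x~v) (y~u , y~v) (z~u , z~v) =
    commonNbrsIndependent T u≢v x≢z y≢z (Adj-sym G x~u) (Adj-sym G y~u) (Adj-sym G z~u)
                                        (Adj-sym G x~v) (Adj-sym G y~v) (Adj-sym G z~v)

  Saturated : Frame → Set
  Saturated F = ∀ j → j ≢ Frame.p F → j ≢ Frame.q F → SeesBoth (Frame.P F) (Frame.Q F) (e₁ j)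

  -- Three orders in which a listing s, p, q, w 0, …, w 3 (numbered 0 … 6) is placed at v₁, …, v₅, x₁, x₂:
  -- p q w₃ w₀ w₂ s w₁, then w₁ w₂ w₃ s q w₀ p, then p q w₃ s w₂ w₀ w₁.
  order₁ order₂ order₃ : Vec (Fin 7) 7
  order₁ = # 1 ∷ # 2 ∷ # 6 ∷ # 3 ∷ # 5 ∷ # 0 ∷ # 4 ∷ []
  order₂ = # 4 ∷ # 5 ∷ # 6 ∷ # 0 ∷ # 2 ∷ # 3 ∷ # 1 ∷ []
  order₃ = # 1 ∷ # 2 ∷ # 6 ∷ # 0 ∷ # 5 ∷ # 3 ∷ # 4 ∷ []

  module _ (F : Frame) where
    open Frame F

    Misses : Fin N → Set
    Misses x = ¬ A x P ⊎ ¬ A x Q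

    missesOrSees : ∀ x → Misses x ⊎ SeesBoth P Q x
    missesOrSees x with decAdj T x P | decAdj T x Q
    ... | no ¬xP | _      = inj₁ (inj₁ ¬xP)
    ... | yes _  | no ¬xQ = inj₁ (inj₂ ¬xQ)
    ... | yes xP | yes xQ = inj₂ (xP , xQ)

    S≁W : ∀ i → ¬ A S (W i)
    S≁W i a with nbrs (w i) a
    ... | inj₁ e = avoids-b i e
    ... | inj₂ e = avoids-c i e

    arrange : (σ : Vec (Fin 7) 7) → {True (injective? (lookup σ))} →
              let d = λ j → e₁ (listing F (lookup σ j)) in
              (∀ j → A (d f5) (d j) → j ≡ f0 ⊎ j ≡ f1) → ¬ A (d f6) (d f4) → ¬ A (d f1) (d f3) → Placement 2 e₁
    arrange σ {ok} = g7-placement G e₁ (λ j → e₁ (listing F (lookup σ j)))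
      (λ eq → table-injective σ {ok} (listing-injective F (e₁-inj eq))) (λ j → listing F (lookup σ j) , refl)

    leaf₁ : ¬ A (W f1) (W f2) → ¬ A Q (W f0) → Placement 2 e₁
    leaf₁ ¬12 ¬Q0 = arrange order₁ x₁-nbrs ¬12 ¬Q0
      where
        x₁-nbrs : ∀ j → A S (e₁ (listing F (lookup order₁ j))) → j ≡ f0 ⊎ j ≡ f1
        x₁-nbrs f0 _ = inj₁ refl
        x₁-nbrs f1 _ = inj₂ refl
        x₁-nbrs f2 a = ⊥-elim (S≁W f3 a)
        x₁-nbrs f3 a = ⊥-elim (S≁W f0 a)
        x₁-nbrs f4 a = ⊥-elim (S≁W f2 a)
        x₁-nbrs f5 a = ⊥-elim (Adj-irr G a)
        x₁-nbrs f6 a = ⊥-elim (S≁W f1 a)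

    leaf₂ : ¬ A (W f0) (W f3) → ¬ A (W f0) Q → ¬ A (W f0) P → ¬ A P Q → Placement 2 e₁
    leaf₂ ¬03 ¬0Q ¬0P ¬PQ =
      arrange order₂ x₁-nbrs ¬PQ (λ a → S≁W f2 (Adj-sym G a))
      where
        x₁-nbrs : ∀ j → A (W f0) (e₁ (listing F (lookup order₂ j))) → j ≡ f0 ⊎ j ≡ f1
        x₁-nbrs f0 _ = inj₁ refl
        x₁-nbrs f1 _ = inj₂ refl
        x₁-nbrs f2 a = ⊥-elim (¬03 a)
        x₁-nbrs f3 a = ⊥-elim (S≁W f0 (Adj-sym G a))
        x₁-nbrs f4 a = ⊥-elim (¬0Q a)
        x₁-nbrs f5 a = ⊥-elim (Adj-irr G a)
        x₁-nbrs f6 a = ⊥-elim (¬0P a)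

    leaf₃ : ¬ A (W f0) (W f1) → ¬ A (W f0) (W f2) → ¬ A (W f0) (W f3) → ¬ A (W f1) (W f2) → ¬ A Q S →
            Placement 2 e₁
    leaf₃ ¬01 ¬02 ¬03 ¬12 ¬QS = arrange order₃ x₁-nbrs ¬12 ¬QS
      where
        x₁-nbrs : ∀ j → A (W f0) (e₁ (listing F (lookup order₃ j))) → j ≡ f0 ⊎ j ≡ f1
        x₁-nbrs f0 _ = inj₁ refl
        x₁-nbrs f1 _ = inj₂ refl
        x₁-nbrs f2 a = ⊥-elim (¬03 a)
        x₁-nbrs f3 a = ⊥-elim (S≁W f0 (Adj-sym G a))
        x₁-nbrs f4 a = ⊥-elim (¬02 a)
        x₁-nbrs f5 a = ⊥-elim (Adj-irr G a)
        x₁-nbrs f6 a = ⊥-elim (¬01 a)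

  -- leaf₁ and leaf₃ only need the designated vertex to miss one of P, Q: exchange p and q if necessary.
  leaf₁′ : (F : Frame) → ¬ A (Frame.W F f1) (Frame.W F f2) → Misses F (Frame.W F f0) → Placement 2 e₁
  leaf₁′ F ¬12 (inj₁ ¬0P) = leaf₁ (swapPQ F) ¬12 (λ a → ¬0P (Adj-sym G a))
  leaf₁′ F ¬12 (inj₂ ¬0Q) = leaf₁ F ¬12 (λ a → ¬0Q (Adj-sym G a))

  leaf₃′ : (F : Frame) → let open Frame F in
           ¬ A (W f0) (W f1) → ¬ A (W f0) (W f2) → ¬ A (W f0) (W f3) → ¬ A (W f1) (W f2) → Misses F S → Placement 2 e₁
  leaf₃′ F ¬01 ¬02 ¬03 ¬12 (inj₁ ¬SP) = leaf₃ (swapPQ F) ¬01 ¬02 ¬03 ¬12 (λ a → ¬SP (Adj-sym G a))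
  leaf₃′ F ¬01 ¬02 ¬03 ¬12 (inj₂ ¬SQ) = leaf₃ F ¬01 ¬02 ¬03 ¬12 (λ a → ¬SQ (Adj-sym G a))

  module _ (F : Frame) where
    open Frame F

    W≢ : ∀ {i j} → i ≢ j → W i ≢ W j
    W≢ i≢j e = i≢j (injective (e₁-inj e))

    P≢Q : P ≢ Q
    P≢Q e = p≢q (e₁-inj e)

    W≢P : ∀ i → W i ≢ P
    W≢P i e = avoids-b i (e₁-inj e)

    W≢Q : ∀ i → W i ≢ Q
    W≢Q i e = avoids-c i (e₁-inj e)

    saturate : SeesBoth P Q S → (∀ i → SeesBoth P Q (W i)) → Saturated F
    saturate S-sees W-sees j j≢p j≢q with j ≟ s
    ... | yes refl = S-sees
    ... | no j≢s with onto j j≢s j≢p j≢q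
    ...   | i , refl = W-sees i

    -- W₀ ≁ W₁ and W₂ ≁ W₃, with W₂, W₃ seeing P and Q: if W₀, W₁ and s also see P and Q the frame is
    -- saturated, otherwise leaf₁ or leaf₃ applies.
    separatedPairs : ¬ A (W f0) (W f1) → ¬ A (W f2) (W f3) → SeesBoth P Q (W f2) → SeesBoth P Q (W f3) →
                     Placement 2 e₁ ⊎ Saturated F
    separatedPairs ¬01 ¬23 sees₂ sees₃ with missesOrSees F (W f0) | missesOrSees F (W f1)
    ... | inj₁ m | _ = inj₁ (leaf₁′ (reorder F (# 0 ∷ # 2 ∷ # 3 ∷ # 1 ∷ [])) ¬23 m)
    ... | inj₂ _ | inj₁ m = inj₁ (leaf₁′ (reorder F (# 1 ∷ # 2 ∷ # 3 ∷ # 0 ∷ [])) ¬23 m)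
    ... | inj₂ sees₀ | inj₂ sees₁ with missesOrSees F S
    ...   | inj₂ S-sees = inj₂ (saturate S-sees W-sees)
      where
        W-sees : ∀ i → SeesBoth P Q (W i)
        W-sees f0 = sees₀
        W-sees f1 = sees₁
        W-sees f2 = sees₂
        W-sees f3 = sees₃
    ...   | inj₁ m = inj₁ (leaf₃′ (reorder F (# 0 ∷ # 2 ∷ # 3 ∷ # 1 ∷ [])) ¬02 ¬03 ¬01 ¬23 m)
      where
        ¬02 : ¬ A (W f0) (W f2)
        ¬02 = commonNbrs-≁ P≢Q (W≢ (λ ())) (W≢ (λ ())) sees₀ sees₂ sees₁
        ¬03 : ¬ A (W f0) (W f3)
        ¬03 = commonNbrs-≁ P≢Q (W≢ (λ ())) (W≢ (λ ())) sees₀ sees₃ sees₁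

    module _ (a23 : A (W f2) (W f3)) (sees₂ : SeesBoth P Q (W f2)) (sees₃ : SeesBoth P Q (W f3)) where

      -- P, Q, W₂, W₃ would form a K₄.
      ¬PQ : ¬ A P Q
      ¬PQ aPQ = noK4 T aPQ (Adj-sym G (proj₁ sees₂)) (Adj-sym G (proj₁ sees₃))
                           (Adj-sym G (proj₂ sees₂)) (Adj-sym G (proj₂ sees₃)) a23

      -- A member adjacent to W₂ and W₃ shares them as common neighbours with P and Q.
      misses-both : ∀ i → SeesBoth (W f2) (W f3) (W i) → ¬ A (W i) P × ¬ A (W i) Q
      misses-both i seesW =
        commonNbrs-≁ (W≢ (λ ())) (W≢Q i) P≢Q seesW P-sees Q-sees ,
        commonNbrs-≁ (W≢ (λ ())) (W≢P i) (λ e → P≢Q (sym e)) seesW Q-sees P-sees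
        where
          P-sees : SeesBoth (W f2) (W f3) P
          P-sees = Adj-sym G (proj₁ sees₂) , Adj-sym G (proj₁ sees₃)
          Q-sees : SeesBoth (W f2) (W f3) Q
          Q-sees = Adj-sym G (proj₂ sees₂) , Adj-sym G (proj₂ sees₃)

      -- W₀ or W₁ misses P or Q, since otherwise W₂, W₃, W₀ are common neighbours of P, Q and W₂ ~ W₃.
      W₀-or-W₁-misses : (Misses F (W f0) → Placement 2 e₁) → (Misses F (W f1) → Placement 2 e₁) → Placement 2 e₁
      W₀-or-W₁-misses via₀ via₁ with missesOrSees F (W f0) | missesOrSees F (W f1)
      ... | inj₁ m | _ = via₀ m
      ... | inj₂ _ | inj₁ m = via₁ m
      ... | inj₂ sees₀ | inj₂ _ = ⊥-elim (commonNbrs-≁ P≢Q (W≢ (λ ())) (W≢ (λ ())) sees₂ sees₃ sees₀ a23)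

      -- W₀ ≁ W₁ and W₂ ~ W₃, with W₂, W₃ seeing P and Q: if W₀ or W₁ is adjacent to both W₂ and W₃ then
      -- leaf₂ applies, otherwise each misses one of W₂, W₃ and leaf₁ applies.
      adjacentPair : ¬ A (W f0) (W f1) → Placement 2 e₁
      adjacentPair ¬01
        with decAdj T (W f0) (W f2) | decAdj T (W f0) (W f3) | decAdj T (W f1) (W f2) | decAdj T (W f1) (W f3)
      ... | yes a02 | yes a03 | _ | _ =
        let (¬0P , ¬0Q) = misses-both f0 (a02 , a03) in
        leaf₂ (reorder F (# 0 ∷ # 2 ∷ # 3 ∷ # 1 ∷ [])) ¬01 ¬0Q ¬0P ¬PQ
      ... | _ | _ | yes a12 | yes a13 =
        let (¬1P , ¬1Q) = misses-both f1 (a12 , a13) in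
        leaf₂ (reorder F (# 1 ∷ # 2 ∷ # 3 ∷ # 0 ∷ [])) (λ a → ¬01 (Adj-sym G a)) ¬1Q ¬1P ¬PQ
      ... | no ¬02 | _ | no ¬12 | _ =
        W₀-or-W₁-misses (leaf₁′ F ¬12) (leaf₁′ (reorder F (# 1 ∷ # 0 ∷ # 2 ∷ # 3 ∷ [])) ¬02)
      ... | no ¬02 | _ | yes _ | no ¬13 =
        W₀-or-W₁-misses (leaf₁′ (reorder F (# 0 ∷ # 1 ∷ # 3 ∷ # 2 ∷ [])) ¬13)
                        (leaf₁′ (reorder F (# 1 ∷ # 0 ∷ # 2 ∷ # 3 ∷ [])) ¬02)
      ... | yes _ | no ¬03 | no ¬12 | _ =
        W₀-or-W₁-misses (leaf₁′ F ¬12) (leaf₁′ (reorder F (# 1 ∷ # 0 ∷ # 3 ∷ # 2 ∷ [])) ¬03)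
      ... | yes _ | no ¬03 | yes _ | no ¬13 =
        W₀-or-W₁-misses (leaf₁′ (reorder F (# 0 ∷ # 1 ∷ # 3 ∷ # 2 ∷ [])) ¬13)
                        (leaf₁′ (reorder F (# 1 ∷ # 0 ∷ # 3 ∷ # 2 ∷ [])) ¬03)

    -- W₀ ≁ W₁: if W₂ or W₃ misses P or Q, leaf₁ applies; otherwise split on whether W₂ ~ W₃.
    nonAdjacentPair : ¬ A (W f0) (W f1) → Placement 2 e₁ ⊎ Saturated F
    nonAdjacentPair ¬01 with missesOrSees F (W f2) | missesOrSees F (W f3)
    ... | inj₁ m | _ = inj₁ (leaf₁′ (reorder F (# 2 ∷ # 0 ∷ # 1 ∷ # 3 ∷ [])) ¬01 m)
    ... | inj₂ _ | inj₁ m = inj₁ (leaf₁′ (reorder F (# 3 ∷ # 0 ∷ # 1 ∷ # 2 ∷ [])) ¬01 m)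
    ... | inj₂ sees₂ | inj₂ sees₃ with decAdj T (W f2) (W f3)
    ...   | no ¬23 = separatedPairs ¬01 ¬23 sees₂ sees₃
    ...   | yes a23 = inj₁ (adjacentPair a23 sees₂ sees₃ ¬01)

  -- Seven vertices with a frame can be placed in G(7) unless the frame is saturated: some two of the
  -- four w's are non-adjacent (the four do not form a K₄), and we may list them first.
  analyse : (F : Frame) → Placement 2 e₁ ⊎ Saturated F
  analyse F with decAdj T (W f0) (W f1) | decAdj T (W f0) (W f2) | decAdj T (W f0) (W f3)
               | decAdj T (W f1) (W f2) | decAdj T (W f1) (W f3) | decAdj T (W f2) (W f3)
    where open Frame F
  ... | no ¬01 | _ | _ | _ | _ | _ = nonAdjacentPair F ¬01
  ... | _ | no ¬02 | _ | _ | _ | _ = nonAdjacentPair (reorder F (# 0 ∷ # 2 ∷ # 1 ∷ # 3 ∷ [])) ¬02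
  ... | _ | _ | no ¬03 | _ | _ | _ = nonAdjacentPair (reorder F (# 0 ∷ # 3 ∷ # 1 ∷ # 2 ∷ [])) ¬03
  ... | _ | _ | _ | no ¬12 | _ | _ = nonAdjacentPair (reorder F (# 1 ∷ # 2 ∷ # 0 ∷ # 3 ∷ [])) ¬12
  ... | _ | _ | _ | _ | no ¬13 | _ = nonAdjacentPair (reorder F (# 1 ∷ # 3 ∷ # 0 ∷ # 2 ∷ [])) ¬13
  ... | _ | _ | _ | _ | _ | no ¬23 = nonAdjacentPair (reorder F (# 2 ∷ # 3 ∷ # 0 ∷ # 1 ∷ [])) ¬23
  ... | yes a01 | yes a02 | yes a03 | yes a12 | yes a13 | yes a23 = ⊥-elim (noK4 T a01 a02 a03 a12 a13 a23)


module TenVertices {N} {G : Graph N} (T : TwoTree G) where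
  open Embedding G

  A : Fin N → Fin N → Set
  A = Adj G

  module _ (e : Fin 10 → Fin N) (e-inj : Inj e) where

    π₁ : Pivot e
    π₁ = pivot T e e-inj
    open Pivot π₁ using () renaming (s to s₁; p to p₁; q to q₁; nbrs to nbrs₁)
    open Complement3 (others π₁) using () renaming
      (elem to g; injective to g-inj; onto to g-onto; avoids-a to g≢s₁; avoids-b to g≢p₁; avoids-c to g≢q₁)

    e₁ : Fin 7 → Fin N
    e₁ = e ∘ g

    e₁-inj : Inj e₁
    e₁-inj eq = g-inj (e-inj eq)

    open SevenVertices T e₁-inj using (Frame; frameOf; Saturated; analyse)

    F : Frame
    F = frameOf (pivot T e₁ e₁-inj)
    open Frame F

    P₁ Q₁ : Fin N
    P₁ = e p₁
    Q₁ = e q₁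

    module _ (saturated : Saturated F) where

      L : Fin 5 → Fin 7
      L f0 = s
      L (suc i) = w i

      L-inj : Inj L
      L-inj {f0} {f0} _ = refl
      L-inj {f0} {suc j} e = ⊥-elim (avoids-a j (sym e))
      L-inj {suc i} {f0} e = ⊥-elim (avoids-a i e)
      L-inj {suc i} {suc j} e = cong suc (injective e)

      L≢p : ∀ i → L i ≢ p
      L≢p f0 = s≢p
      L≢p (suc i) = avoids-b i

      L≢q : ∀ i → L i ≢ q
      L≢q f0 = s≢q
      L≢q (suc i) = avoids-c i

      P≢Q : P ≢ Q
      P≢Q eq = p≢q (e₁-inj eq)

      L≢ : ∀ {i j} → i ≢ j → L i ≢ L j
      L≢ i≢j eq = i≢j (L-inj eq)

      -- The members other than p, q are pairwise non-adjacent: with a third such member they are common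
      -- neighbours of P and Q.

      independent : ∀ {x y} → x ≢ y → x ≢ p → x ≢ q → y ≢ p → y ≢ q → ¬ A (e₁ x) (e₁ y)
      independent {x} {y} x≢y x≢p x≢q y≢p y≢q =
        let (i , Li≢x , Li≢y) = third in
        SevenVertices.commonNbrs-≁ T e₁-inj P≢Q (λ eq → Li≢x (sym (e₁-inj eq))) (λ eq → Li≢y (sym (e₁-inj eq)))
          (saturated x x≢p x≢q) (saturated y y≢p y≢q) (saturated (L i) (L≢p i) (L≢q i))
        where
          third : ∃ λ i → L i ≢ x × L i ≢ y
          third with neitherOr (L f0 ≟ x) (L f0 ≟ y) | neitherOr (L f1 ≟ x) (L f1 ≟ y) | neitherOr (L f2 ≟ x) (L f2 ≟ y)
          ... | inj₁ (a , b) | _ | _ = f0 , a , b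
          ... | inj₂ _ | inj₁ (a , b) | _ = f1 , a , b
          ... | inj₂ _ | inj₂ _ | inj₁ (a , b) = f2 , a , b
          ... | inj₂ h₀ | inj₂ h₁ | inj₂ h₂ =
            ⊥-elim (noThreeInPair {A = λ i → L i ≡ x ⊎ L i ≡ y} L (λ _ h → h) {f0} {f1} {f2}
                      (L≢ {f0} {f1} (λ ())) (L≢ {f0} {f2} (λ ())) (L≢ {f1} {f2} (λ ())) h₀ h₁ h₂)

      P₁≢P : P₁ ≢ P
      P₁≢P eq = g≢p₁ p (sym (e-inj eq))

      P₁≢Q : P₁ ≢ Q
      P₁≢Q eq = g≢p₁ q (sym (e-inj eq))

      Q₁≢P : Q₁ ≢ P
      Q₁≢P eq = g≢q₁ p (sym (e-inj eq))

      Q₁≢Q : Q₁ ≢ Q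
      Q₁≢Q eq = g≢q₁ q (sym (e-inj eq))

      -- A vertex X ≠ P, Q sees at most two members of L: otherwise X, P, Q and three of L form a K₃,₃.
      atMostTwoNbrs : ∀ X → X ≢ P → X ≢ Q → ∀ {i j k} → i ≢ j → i ≢ k → j ≢ k →
                      A X (e₁ (L i)) → A X (e₁ (L j)) → A X (e₁ (L k)) → ⊥
      atMostTwoNbrs X X≢P X≢Q {i} {j} {k} i≢j i≢k j≢k Xi Xj Xk =
        noK33 T X≢P X≢Q P≢Q (≠ i≢j) (≠ i≢k) (≠ j≢k) Xi Xj Xk (P~ i) (P~ j) (P~ k) (Q~ i) (Q~ j) (Q~ k)
        where
          ≠ : ∀ {i j} → i ≢ j → e₁ (L i) ≢ e₁ (L j)
          ≠ i≢j eq = L≢ i≢j (e₁-inj eq)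
          P~ : ∀ i → A P (e₁ (L i))
          P~ i = Adj-sym G (proj₁ (saturated (L i) (L≢p i) (L≢q i)))
          Q~ : ∀ i → A Q (e₁ (L i))
          Q~ i = Adj-sym G (proj₂ (saturated (L i) (L≢p i) (L≢q i)))

      -- Hence some member of L sees neither P₁ nor Q₁: otherwise three members of L see the same one.
      seesNeither : ∃ λ k → ¬ A (e₁ (L k)) P₁ × ¬ A (e₁ (L k)) Q₁
      seesNeither with any? (λ i → ¬? (decAdj T (e₁ (L i)) P₁) ×-dec ¬? (decAdj T (e₁ (L i)) Q₁))
      ... | yes found = found
      ... | no none with majority5 colour
        where
          colour : Fin 5 → Bool
          colour i = isYes (decAdj T (e₁ (L i)) P₁)
      ...   | true , i , j , k , i≢j , i≢k , j≢k , ci , cj , ck =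
        ⊥-elim (atMostTwoNbrs P₁ P₁≢P P₁≢Q i≢j i≢k j≢k (P₁~ i ci) (P₁~ j cj) (P₁~ k ck))
        where
          P₁~ : ∀ i → isYes (decAdj T (e₁ (L i)) P₁) ≡ true → A P₁ (e₁ (L i))
          P₁~ i c with decAdj T (e₁ (L i)) P₁
          P₁~ i c | yes a = Adj-sym G a
          P₁~ i () | no _
      ...   | false , i , j , k , i≢j , i≢k , j≢k , ci , cj , ck =
        ⊥-elim (atMostTwoNbrs Q₁ Q₁≢P Q₁≢Q i≢j i≢k j≢k (Q₁~ i ci) (Q₁~ j cj) (Q₁~ k ck))
        where
          Q₁~ : ∀ i → isYes (decAdj T (e₁ (L i)) P₁) ≡ false → A Q₁ (e₁ (L i))
          Q₁~ i c with decAdj T (e₁ (L i)) P₁ | decAdj T (e₁ (L i)) Q₁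
          Q₁~ i () | yes _ | _
          Q₁~ i c | no _ | yes a = Adj-sym G a
          Q₁~ i c | no ¬P | no ¬Q = ⊥-elim (none (i , ¬P , ¬Q))

      -- Second attempt: ℓ ∈ L seeing neither P₁ nor Q₁ is a pivot of the ten with slots p, q; the seven
      -- vertices remaining (s₁, p₁, q₁ and L − ℓ) with the frame at s₁ are placed in G(7), because that
      -- frame is not saturated: P₁ would see all of L − ℓ.
      module _ (k : Fin 5) (¬ℓP₁ : ¬ A (e₁ (L k)) P₁) (¬ℓQ₁ : ¬ A (e₁ (L k)) Q₁) where
        ℓ : Fin 7
        ℓ = L k

        ℓ-nbrs : ∀ j → A (e (g ℓ)) (e j) → j ≡ g p ⊎ j ≡ g q
        ℓ-nbrs j ℓ~j with j ≟ s₁ | j ≟ p₁ | j ≟ q₁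
        ... | yes refl | _ | _ = ⊥-elim ([ g≢p₁ ℓ , g≢q₁ ℓ ] (nbrs₁ (g ℓ) (Adj-sym G ℓ~j)))
        ... | no _ | yes refl | _ = ⊥-elim (¬ℓP₁ ℓ~j)
        ... | no _ | no _ | yes refl = ⊥-elim (¬ℓQ₁ ℓ~j)
        ... | no j≢s₁ | no j≢p₁ | no j≢q₁ with g-onto j j≢s₁ j≢p₁ j≢q₁
        ...   | j′ , refl with j′ ≟ p | j′ ≟ q
        ...     | yes refl | _ = inj₁ refl
        ...     | no _ | yes refl = inj₂ refl
        ...     | no j′≢p | no j′≢q =
          ⊥-elim (independent (λ eq → adj⇒≢ G ℓ~j (cong (e ∘ g) eq)) (L≢p k) (L≢q k) j′≢p j′≢q ℓ~j)

        π₂ : Pivot e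
        π₂ = record
          { s = g ℓ ; p = g p ; q = g q
          ; p≢q = λ eq → p≢q (g-inj eq) ; s≢p = λ eq → L≢p k (g-inj eq) ; s≢q = λ eq → L≢q k (g-inj eq)
          ; nbrs = ℓ-nbrs }

        open Complement3 (others π₂) using () renaming (elem to g₂; injective to g₂-inj; onto to g₂-onto)

        e₂ : Fin 7 → Fin N
        e₂ = e ∘ g₂

        e₂-inj : Inj e₂
        e₂-inj eq = g₂-inj (e-inj eq)

        kept : ∀ x → (∀ y → g y ≢ x) → ∃ λ z → g₂ z ≡ x
        kept x g≢x = g₂-onto x (λ eq → g≢x ℓ (sym eq)) (λ eq → g≢x p (sym eq)) (λ eq → g≢x q (sym eq))

        π₁′ : Pivot e₂
        π₁′ = restrictPivot g₂ g₂-inj π₁ (kept s₁ g≢s₁) (kept p₁ g≢p₁) (kept q₁ g≢q₁)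

        open SevenVertices T e₂-inj using () renaming
          (Frame to Frame₂; frameOf to frameOf₂; Saturated to Saturated₂; analyse to analyse₂)

        F₂ : Frame₂
        F₂ = frameOf₂ π₁′

        not-saturated : ¬ Saturated₂ F₂
        not-saturated saturated₂ =
          atMostTwoNbrs P₁ P₁≢P P₁≢Q (punchIn-≢ {f0} {f1} (λ ())) (punchIn-≢ {f0} {f2} (λ ())) (punchIn-≢ {f1} {f2} (λ ()))
                        (P₁~ f0) (P₁~ f1) (P₁~ f2)
          where
            punchIn-≢ : ∀ {i j} → i ≢ j → punchIn k i ≢ punchIn k j
            punchIn-≢ i≢j eq = i≢j (punchIn-injective k _ _ eq)
            survivor : ∀ i → ∃ λ z → g₂ z ≡ g (L (punchIn k i))
            survivor i = g₂-onto _ (λ eq → punchInᵢ≢i k i (L-inj (g-inj eq)))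
                                   (λ eq → L≢p (punchIn k i) (g-inj eq)) (λ eq → L≢q (punchIn k i) (g-inj eq))
            ≢kept : ∀ {z} i → g₂ z ≡ g (L (punchIn k i)) → ∀ x (g≢x : ∀ y → g y ≢ x) → z ≢ proj₁ (kept x g≢x)
            ≢kept i g₂z x g≢x eq = g≢x (L (punchIn k i)) (trans (sym g₂z) (trans (cong g₂ eq) (proj₂ (kept x g≢x))))
            P₁~ : ∀ i → A P₁ (e₁ (L (punchIn k i)))
            P₁~ i = let (z , g₂z) = survivor i in
              subst₂ A (cong e (proj₂ (kept p₁ g≢p₁))) (cong e g₂z)
                (Adj-sym G (proj₁ (saturated₂ z (≢kept i g₂z p₁ g≢p₁) (≢kept i g₂z q₁ g≢q₁))))

        secondAttempt : Placement 3 e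
        secondAttempt with analyse₂ F₂
        ... | inj₁ placed = extend 0 e e-inj π₂ placed
        ... | inj₂ saturated₂ = ⊥-elim (not-saturated saturated₂)

    -- Ten vertices of a 2-tree can be placed in G(10): either the seven left after removing a pivot can be
    -- placed in G(7), or their frame is saturated and the second attempt succeeds.
    base : Placement 3 e
    base with analyse F
    ... | inj₁ placed = extend 0 e e-inj π₁ placed
    ... | inj₂ saturated =
      let (k , ¬ℓP₁ , ¬ℓQ₁) = seesNeither saturated in secondAttempt saturated k ¬ℓP₁ ¬ℓQ₁

module _ {N} {G : Graph N} (T : TwoTree G) where
  open Embedding G

  reindex : ∀ {k M M′} {e : Fin M → Fin N} (h : Fin M′ → Fin M) → Placement k (e ∘ h) → Placement k e
  reindex h P = record
    { at = at ; at-injective = at-injective ; at-edges = at-edges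
    ; at-member = λ j → let (i , eq) = at-member j in h i , eq }
    where open Placement P

  placeAll : ∀ k (e : Fin (3 * (3 + k) + 1) → Fin N) → Inj e → Placement (3 + k) e
  placeAll zero e e-inj = TenVertices.base T e e-inj
  placeAll (suc k) e e-inj =
    reindex (cast (size k)) (extend (suc k) e′ e′-inj π (placeAll k (e′ ∘ elem) (λ eq → injective (e′-inj eq))))
    where
      size : ∀ k → 3 + (3 * (3 + k) + 1) ≡ 3 * (3 + suc k) + 1
      size = solve-∀
      e′ : Fin (3 + (3 * (3 + k) + 1)) → Fin N
      e′ = e ∘ cast (size k)
      e′-inj : Inj e′
      e′-inj {x} {y} eq = toℕ-injective (begin
        toℕ x                 ≡⟨ sym (toℕ-cast (size k) x) ⟩
        toℕ (cast (size k) x) ≡⟨ cong toℕ (e-inj eq) ⟩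
        toℕ (cast (size k) y) ≡⟨ toℕ-cast (size k) y ⟩
        toℕ y ∎)
        where open ≡-Reasoning
      π : Pivot e′
      π = pivot T e′ e′-inj
      open Complement3 (others π) using (elem; injective)

placement⇒subgraph : ∀ t (G : Graph (3 * t + 1)) → Embedding.Placement G t (λ x → x) → G ⊆G Gspecial t
placement⇒subgraph t G P = f , f-inj , f-edges
  where
    open Embedding.Placement P
    surj : ∀ u → ∃ λ j → at j ≡ u
    surj = injective⇒surjective at at-injective
    f : Fin (3 * t + 1) → Fin (3 * t + 1)
    f u = proj₁ (surj u)
    at-f : ∀ u → at (f u) ≡ u
    at-f u = proj₂ (surj u)
    f-inj : Inj f
    f-inj {u} {w} eq = trans (sym (at-f u)) (trans (cong at eq) (at-f w))
    f-edges : ∀ u w → Adj G u w → Adj (Gspecial t) (f u) (f w)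
    f-edges u w a = at-edges (f u) (f w) (subst₂ (Adj G) (sym (at-f u)) (sym (at-f w)) a)

lemma4p2p2 : (t : ℕ) → 3 ≤ t → (G : Graph (3 * t + 1)) → TwoTree G → G ⊆G Gspecial t
lemma4p2p2 (suc (suc (suc k))) (s≤s (s≤s (s≤s z≤n))) G T =
  placement⇒subgraph (3 + k) G (placeAll T k (λ x → x) (λ eq → eq))
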